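{- Let $\vec y.u$ and $\vec y.v$ be terms, where $\vec y=y_1,\dots,y_n$ and $\vec y.v$ is expanded. Let $\theta=\{y_1\mapsto s_1,\dots,y_n\mapsto s_n\}$ be a substitution, with $s_i$ of the same type as $y_i$, such that $x_1,\dots,x_k.s_i$ is an expanded term for all $1\le i\le n$. If $\vec y.u\trianglerighteq_E\vec y.v$, then $x_1,\dots,x_k.u\theta\trianglerighteq_E x_1,\dots,x_k.v\theta$.
   Context: Terms are simply-typed $\lambda$-terms in $\beta\eta$-long normal form. Types are sorts $a$ or $(\sigma_1,\dots,\sigma_n)\to a$. There are typed variables, infinitely many of each type, and typed function symbols. Terms are generated as follows. If a head $h$ has type $(\sigma_1,\dots,\sigma_n)\to a$ and $t_i:\sigma_i$, then $h(t_1,\dots,t_n):a$. If $t:a$ and $x_i:\sigma_i$, then $x_1,\dots,x_n.t:(\sigma_1,\dots,\sigma_n)\to a$. Terms are taken modulo $\alpha$-renaming, and bound variables are distinct and never free. $\mathrm{fv}$ denotes free variables. $x{\downarrow}=y_1,\dots,y_n.x(y_1{\downarrow},\dots,y_n{\downarrow})$ is the $\eta$-expansion of $x:(\sigma_1,\dots,\sigma_n)\to a$. Subterms: $\vec x.h(s_1,\dots,s_m)\trianglerighteq t$ iff the two are equal or $\vec x.s_i\trianglerighteq t$ for some $i$, with binder prefixes concatenated. Substitution application is hereditary and capture-avoiding: - $x(\vec t)\theta=w\{\vec z\mapsto\vec t\theta\}$ if $\theta(x)=\vec z.w$; - $h(\vec t)\theta=h(\vec t\theta)$ if $h\notin\mathrm{dom}(\theta)$;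 - $(\vec x.t)\theta=\vec z.(t\{\vec x\mapsto\vec z\}\theta)$ for fresh $\vec z$. Expanded terms: $\vec x.s$ is expanded if it equals $\vec x,y_1,\dots,y_k.h(s_1,\dots,s_m,y_1{\downarrow},\dots,y_k{\downarrow})$ with $(\bigcup_i\mathrm{fv}(s_i)\cup\{h\})\cap\{\vec y\}=\varnothing$. Expanded subterms: for $\vec x=x_1,\dots,x_n$, a term $\vec x.s$, and an expanded term $\vec x.t=\vec x,y_1,\dots,y_k.h(t_1,\dots,t_m,\vec y{\downarrow})$, we write $\vec x.s\trianglerighteq_E\vec x.t$ iff there are $n'\ge n$ and terms $x_1,\dots,x_{n'}.t_{m+1},\dots,x_1,\dots,x_{n'}.t_{m+k}$ with $\vec x.s\trianglerighteq x_1,\dots,x_{n'}.h(t_1,\dots,t_{m+k})$. -}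

module Defs where

open import Data.List using (List; []; _∷_; _++_)
open import Data.Product using (Σ; Σ-syntax; _×_; _,_)
open import Data.Sum using (_⊎_; inj₁; inj₂)
open import Data.Unit using (⊤; tt)
open import Relation.Binary.PropositionalEquality using (_≡_)

-- Types.  A sort a is identified with the type () → a.

data Ty (S : Set) : Set where
  _⇒_ : List (Ty S) → S → Ty S

module _ {S : Set} where

  -- Contexts: the head of the list is the most recently bound variable.
  Ctx : Set
  Ctx = List (Ty S)

  data _∋_ : Ctx → Ty S → Set where
    here  : ∀ {Γ σ} → (σ ∷ Γ) ∋ σ
    there : ∀ {Γ σ τ} → Γ ∋ σ → (τ ∷ Γ) ∋ σ

  -- Γ ⧺ Δ : extend Γ by binders Δ = σ₁,…,σₙ (σₙ is the innermost).
  infixl 5 _⧺_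
  _⧺_ : Ctx → List (Ty S) → Ctx
  Γ ⧺ []      = Γ
  Γ ⧺ (σ ∷ Δ) = (σ ∷ Γ) ⧺ Δ

  Ren : Ctx → Ctx → Set
  Ren Γ Γ' = ∀ {τ} → Γ ∋ τ → Γ' ∋ τ

  lift : ∀ {Γ Γ' σ} → Ren Γ Γ' → Ren (σ ∷ Γ) (σ ∷ Γ')
  lift ρ here      = here
  lift ρ (there x) = there (ρ x)

  liftₙ : ∀ {Γ Γ'} (Δ : List (Ty S)) → Ren Γ Γ' → Ren (Γ ⧺ Δ) (Γ' ⧺ Δ)
  liftₙ []      ρ = ρ
  liftₙ (σ ∷ Δ) ρ = liftₙ Δ (lift ρ)

  wk : ∀ {Γ} (Δ : List (Ty S)) → Ren Γ (Γ ⧺ Δ)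
  wk []      x = x
  wk (σ ∷ Δ) x = wk Δ (there x)

  bvar : ∀ {Γ} (Δ : List (Ty S)) → Ren Δ (Γ ⧺ Δ)
  bvar (σ ∷ Δ) here      = wk Δ here
  bvar (σ ∷ Δ) (there j) = bvar Δ j

  -- environment of a substitution: each variable of Ξ is either kept
  -- (renamed into Γ') or belongs to the domain Θ of the substitution
  Env : Ctx → Ctx → List (Ty S) → Set
  Env Ξ Γ' Θ = ∀ {τ} → Ξ ∋ τ → (Γ' ∋ τ) ⊎ (Θ ∋ τ)

  liftEnv : ∀ {Ξ Γ' Θ σ} → Env Ξ Γ' Θ → Env (σ ∷ Ξ) (σ ∷ Γ') Θ
  liftEnv e here      = inj₁ here
  liftEnv e (there x) with e x
  ... | inj₁ y = inj₁ (there y)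
  ... | inj₂ i = inj₂ i

  liftEnvₙ : ∀ {Ξ Γ' Θ} (Δ : List (Ty S)) → Env Ξ Γ' Θ → Env (Ξ ⧺ Δ) (Γ' ⧺ Δ) Θ
  liftEnvₙ []      e = e
  liftEnvₙ (σ ∷ Δ) e = liftEnvₙ Δ (liftEnv e)

  split : ∀ {Γ} (Δ : List (Ty S)) → Env (Γ ⧺ Δ) Γ Δ
  split []      x = inj₁ x
  split (σ ∷ Δ) x with split Δ x
  ... | inj₁ here      = inj₂ here
  ... | inj₁ (there y) = inj₁ y
  ... | inj₂ j         = inj₂ (there j)

module _ {S : Set} (F : Ty S → Set) where

  data Head (Γ : Ctx) (τ : Ty S) : Set where
    var : Γ ∋ τ → Head Γ τ
    fun : F τ → Head Γ τ

  -- Ne Γ a : terms h(t₁,…,tₙ) of sort a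
  -- Args Γ Θ : argument lists t₁,…,tₙ with tᵢ : Tm Γ σᵢ
  data Ne (Γ : Ctx) (a : S) : Set
  data Args (Γ : Ctx) : List (Ty S) → Set

  data Ne Γ a where
    _$_ : ∀ {Θ} → Head Γ (Θ ⇒ a) → Args Γ Θ → Ne Γ a

  data Args Γ where
    []  : Args Γ []
    _∷_ : ∀ {Δ b Θ} → Ne (Γ ⧺ Δ) b → Args Γ Θ → Args Γ ((Δ ⇒ b) ∷ Θ)

  -- A term x⃗.t : (σ⃗) → a in context Γ is its body t : a in context Γ, x⃗.
  Tm : Ctx → Ty S → Set
  Tm Γ (Δ ⇒ a) = Ne (Γ ⧺ Δ) a

  _++ᴬ_ : ∀ {Γ Θ Ψ} → Args Γ Θ → Args Γ Ψ → Args Γ (Θ ++ Ψ)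
  []       ++ᴬ vs = vs
  (u ∷ us) ++ᴬ vs = u ∷ (us ++ᴬ vs)

  renH : ∀ {Γ Γ' τ} → Ren Γ Γ' → Head Γ τ → Head Γ' τ
  renH ρ (var x) = var (ρ x)
  renH ρ (fun f) = fun f

  renNe   : ∀ {Γ Γ' a} → Ren Γ Γ' → Ne Γ a → Ne Γ' a
  renArgs : ∀ {Γ Γ' Θ} → Ren Γ Γ' → Args Γ Θ → Args Γ' Θ
  renNe ρ (h $ us) = renH ρ h $ renArgs ρ us
  renArgs ρ [] = []
  renArgs ρ (_∷_ {Δ} u us) = renNe (liftₙ Δ ρ) u ∷ renArgs ρ us

  ηTm   : ∀ {Γ} (τ : Ty S) → Γ ∋ τ → Tm Γ τ
  ηArgs : ∀ {Γ} (Δ : List (Ty S)) → Ren Δ Γ → Args Γ Δ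
  ηTm (Δ ⇒ b) x = var (wk Δ x) $ ηArgs Δ (bvar Δ)
  ηArgs []      f = []
  ηArgs ((Δ' ⇒ b) ∷ Δ) f = ηTm (Δ' ⇒ b) (f here) ∷ ηArgs Δ (λ j → f (there j))

  -- hereditary (simultaneous, capture-avoiding) substitution:
  -- the variables classified into Θ by the environment are replaced by
  -- the corresponding terms of the argument list.
  subNe   : ∀ {Ξ Γ' a} (Θ : List (Ty S)) → Env Ξ Γ' Θ → Args Γ' Θ
            → Ne Ξ a → Ne Γ' a
  subArgs : ∀ {Ξ Γ' Ψ} (Θ : List (Ty S)) → Env Ξ Γ' Θ → Args Γ' Θ
            → Args Ξ Ψ → Args Γ' Ψ
  appl    : ∀ {Γ' Θ₁ b} (Θ : List (Ty S)) → Θ ∋ (Θ₁ ⇒ b) → Args Γ' Θ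
            → Args Γ' Θ₁ → Ne Γ' b
  subNe Θ e ts (fun f $ us) = fun f $ subArgs Θ e ts us
  subNe Θ e ts (var x $ us) with e x
  ... | inj₁ y = var y $ subArgs Θ e ts us
  ... | inj₂ i = appl Θ i ts (subArgs Θ e ts us)
  subArgs Θ e ts [] = []
  subArgs Θ e ts (_∷_ {Δ} u us) =
    subNe Θ (liftEnvₙ Δ e) (renArgs (wk Δ) ts) u ∷ subArgs Θ e ts us
  -- x(t⃗)θ = w{z⃗ ↦ t⃗θ}  where θ(x) = z⃗.w
  appl ((Θ₁ ⇒ b) ∷ Θ) here      (w ∷ ts) us = subNe Θ₁ (split Θ₁) us w
  appl (_ ∷ Θ)        (there i) (_ ∷ ts) us = appl Θ i ts us

  subTm : ∀ {Ξ Γ' Θ} (σ : Ty S) → Env Ξ Γ' Θ → Args Γ' Θ → Tm Ξ σ → Tm Γ' σ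
  subTm {Θ = Θ} (Δ ⇒ a) e ts u = subNe Θ (liftEnvₙ Δ e) (renArgs (wk Δ) ts) u

  -- The substitution θ = {y₁ ↦ s₁, …, yₙ ↦ sₙ}: a term in context Γ, y⃗
  -- is sent to a term in context Γ, x⃗ (other free variables are kept).
  θEnv : ∀ {Γ} (Y X : List (Ty S)) → Env (Γ ⧺ Y) (Γ ⧺ X) Y
  θEnv Y X v with split Y v
  ... | inj₁ y = inj₁ (wk X y)
  ... | inj₂ i = inj₂ i

  applyθ : ∀ {Γ} (Y X : List (Ty S)) (σ : Ty S)
           → Tm (Γ ⧺ Y) σ → Args (Γ ⧺ X) Y → Tm (Γ ⧺ X) σ
  applyθ Y X σ u θ = subTm σ (θEnv Y X) θ u

  -- Expanded terms: Γ.t is expanded iff t = y⃗.h(t₁,…,tₘ,y⃗↓) where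
  -- h and the tᵢ do not contain y⃗ (i.e. they are weakenings).
  Expanded : ∀ {Γ} (τ : Ty S) → Tm Γ τ → Set
  Expanded {Γ} (Y ⇒ a) t =
    Σ[ Θ ∈ List (Ty S) ] Σ[ h ∈ Head Γ ((Θ ++ Y) ⇒ a) ] Σ[ ts ∈ Args Γ Θ ]
      (t ≡ (renH (wk Y) h $ (renArgs (wk Y) ts ++ᴬ ηArgs Y (bvar Y))))

  AllExpanded : ∀ {Γ Θ} → Args Γ Θ → Set
  AllExpanded [] = ⊤
  AllExpanded (_∷_ {Δ} {b} u us) = Expanded (Δ ⇒ b) u × AllExpanded us

  data ArgIn {Γ : Ctx} : ∀ {Θ} (Δ : List (Ty S)) {b : S}
                         → Ne (Γ ⧺ Δ) b → Args Γ Θ → Set where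
    here  : ∀ {Θ Δ b} {u : Ne (Γ ⧺ Δ) b} {us : Args Γ Θ}
            → ArgIn Δ u (_∷_ {Δ = Δ} u us)
    there : ∀ {Θ Δ Δ' b b'} {u : Ne (Γ ⧺ Δ) b} {u' : Ne (Γ ⧺ Δ') b'}
              {us : Args Γ Θ}
            → ArgIn Δ u us → ArgIn Δ u (_∷_ {Δ = Δ'} u' us)

  -- Subterm relation: x⃗.h(s₁,…,sₘ) ⊵ t iff equal or x⃗.sᵢ ⊵ t
  -- (binder prefixes concatenated, reflected in the context).
  data Sub : ∀ {Ξ Ξ' a b} → Ne Ξ a → Ne Ξ' b → Set where
    ⊵-refl : ∀ {Ξ a} {e : Ne Ξ a} → Sub e e
    ⊵-arg  : ∀ {Ξ Ξ' a b c Θ Δ} {h : Head Ξ (Θ ⇒ a)} {us : Args Ξ Θ}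
               {u : Ne (Ξ ⧺ Δ) c} {e' : Ne Ξ' b}
             → ArgIn Δ u us → Sub u e' → Sub (h $ us) e'

  emb : ∀ {Ξ Ξ' a b} {e : Ne Ξ a} {e' : Ne Ξ' b} → Sub e e' → Ren Ξ Ξ'
  emb ⊵-refl x = x
  emb (⊵-arg {Δ = Δ} _ d) x = emb d (wk Δ x)

  -- Expanded subterm: Γ.s ⊵E Γ.t, where Γ.t = Γ,y⃗.h(t₁,…,tₘ,y⃗↓) is
  -- expanded, iff Γ.s ⊵ Γ,z⃗.h(t₁,…,tₘ,tₘ₊₁,…,tₘ₊ₖ) for some z⃗ and
  -- terms tₘ₊₁,…,tₘ₊ₖ.
  ⊵E : ∀ {Γ} (σ τ : Ty S) → Tm Γ σ → Tm Γ τ → Set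
  ⊵E {Γ} (Δ ⇒ c) (Y ⇒ a) s t =
    Σ[ Θ ∈ List (Ty S) ] Σ[ h ∈ Head Γ ((Θ ++ Y) ⇒ a) ] Σ[ ts ∈ Args Γ Θ ]
      ((t ≡ (renH (wk Y) h $ (renArgs (wk Y) ts ++ᴬ ηArgs Y (bvar Y))))
      × Σ[ Ξ' ∈ Ctx ] Σ[ e' ∈ Ne Ξ' a ] Σ[ d ∈ Sub s e' ]
          Σ[ rest ∈ Args Ξ' Y ]
            (e' ≡ (renH (λ x → emb d (wk Δ x)) h
                   $ (renArgs (λ x → emb d (wk Δ x)) ts ++ᴬ rest))))

{-# OPTIONS --safe #-}

-- Write v = y⃗.h(t⃗, y⃗↓). Under θ the partial application h(t⃗) turns into a partial application
-- h*(t⃗*), uniformly in the remaining arguments: h* = h and t⃗* = t⃗θ if h is a symbol or a variable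
-- outside the domain of θ, and if h = yᵢ with θ(yᵢ) = x⃗.h'(r⃗, x⃗↓) expanded, hereditary
-- substitution yields h'(r⃗, t⃗θ, …) because η-expanded variables are units of substitution.
-- Hence vθ = y⃗.h*(t⃗*, y⃗↓) is expanded again. Expandedness of the θ(yᵢ) also makes every head
-- along the subterm path from u to z⃗.h(t⃗, t⃗') keep its substituted arguments as its last
-- arguments, so the path survives substitution and ends at z⃗.h*(t⃗*, t⃗'θ).

module Submission where

open import Defs
open import Data.List using (List; []; _∷_; _++_)
open import Data.List.Properties using (++-assoc)
open import Data.Product using (Σ; Σ-syntax; _,_)
open import Data.Sum using (_⊎_; inj₁; inj₂; [_,_]′; map₁)
open import Data.Sum.Properties using (map-map; map-id; map₁-cong)
open import Function using (id)
open import Relation.Binary.PropositionalEquality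

module _ {S : Set} where

  infix 4 _≗ᴿ_
  _≗ᴿ_ : ∀ {Γ Γ' : Ctx {S}} → Ren Γ Γ' → Ren Γ Γ' → Set
  ρ ≗ᴿ ρ' = ∀ {τ} (x : _ ∋ τ) → ρ x ≡ ρ' x

  data BinderView {Γ : Ctx {S}} (Δ : List (Ty S)) {τ} : (Γ ⧺ Δ) ∋ τ → Set where
    weakened : (y : Γ ∋ τ) → BinderView Δ (wk Δ y)
    bound    : (j : Δ ∋ τ) → BinderView Δ (bvar Δ j)

  binderView : ∀ {Γ : Ctx {S}} (Δ : List (Ty S)) {τ} (x : (Γ ⧺ Δ) ∋ τ) → BinderView Δ x
  binderView []      x = weakened x
  binderView (σ ∷ Δ) x with binderView Δ x
  ... | weakened here      = bound here
  ... | weakened (there y) = weakened y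
  ... | bound j            = bound (there j)

  liftₙ-wk : ∀ {Γ Γ' : Ctx {S}} (Δ : List (Ty S)) (ρ : Ren Γ Γ') {τ} (y : Γ ∋ τ) →
             liftₙ Δ ρ (wk Δ y) ≡ wk Δ (ρ y)
  liftₙ-wk []      ρ y = refl
  liftₙ-wk (σ ∷ Δ) ρ y = liftₙ-wk Δ (lift ρ) (there y)

  liftₙ-bvar : ∀ {Γ Γ' : Ctx {S}} (Δ : List (Ty S)) (ρ : Ren Γ Γ') {τ} (j : Δ ∋ τ) →
               liftₙ {Γ = Γ} Δ ρ (bvar Δ j) ≡ bvar Δ j
  liftₙ-bvar (σ ∷ Δ) ρ here      = liftₙ-wk Δ (lift ρ) here
  liftₙ-bvar (σ ∷ Δ) ρ (there j) = liftₙ-bvar Δ (lift ρ) j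

  liftₙ-∘ : ∀ {Γ Γ' Γ'' : Ctx {S}} (Δ : List (Ty S))
            {ρ : Ren Γ' Γ''} {ρ' : Ren Γ Γ'} {ρ'' : Ren Γ Γ''} →
            (λ x → ρ (ρ' x)) ≗ᴿ ρ'' →
            (λ x → liftₙ Δ ρ (liftₙ Δ ρ' x)) ≗ᴿ liftₙ Δ ρ''
  liftₙ-∘ Δ {ρ} {ρ'} {ρ''} eq x with binderView Δ x
  ... | weakened y
    rewrite liftₙ-wk Δ ρ' y | liftₙ-wk Δ ρ (ρ' y) | liftₙ-wk Δ ρ'' y = cong (wk Δ) (eq y)
  ... | bound j
    rewrite liftₙ-bvar Δ ρ' j | liftₙ-bvar Δ ρ j | liftₙ-bvar Δ ρ'' j = refl

  liftₙ-cong : ∀ {Γ Γ' : Ctx {S}} (Δ : List (Ty S)) {ρ ρ' : Ren Γ Γ'} →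
               ρ ≗ᴿ ρ' → liftₙ Δ ρ ≗ᴿ liftₙ Δ ρ'
  liftₙ-cong Δ {ρ} {ρ'} eq x with binderView Δ x
  ... | weakened y rewrite liftₙ-wk Δ ρ y | liftₙ-wk Δ ρ' y = cong (wk Δ) (eq y)
  ... | bound j    rewrite liftₙ-bvar Δ ρ j | liftₙ-bvar Δ ρ' j = refl

  liftₙ-id : ∀ {Γ : Ctx {S}} (Δ : List (Ty S)) → liftₙ {Γ = Γ} Δ id ≗ᴿ id
  liftₙ-id Δ x with binderView Δ x
  ... | weakened y = liftₙ-wk Δ id y
  ... | bound j    = liftₙ-bvar Δ id j

  liftEnv-there : ∀ {Ξ Γ' : Ctx {S}} {Θ σ} (e : Env Ξ Γ' Θ) {τ} (x : Ξ ∋ τ) →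
                  liftEnv {σ = σ} e (there x) ≡ map₁ there (e x)
  liftEnv-there e x with e x
  ... | inj₁ y = refl
  ... | inj₂ i = refl

  liftEnvₙ-wk : ∀ {Ξ Γ' : Ctx {S}} {Θ} (Δ : List (Ty S)) (e : Env Ξ Γ' Θ) {τ} (x : Ξ ∋ τ) →
                liftEnvₙ Δ e (wk Δ x) ≡ map₁ (wk Δ) (e x)
  liftEnvₙ-wk [] e x with e x
  ... | inj₁ y = refl
  ... | inj₂ i = refl
  liftEnvₙ-wk (σ ∷ Δ) e x = begin
    liftEnvₙ Δ (liftEnv e) (wk Δ (there x))  ≡⟨ liftEnvₙ-wk Δ (liftEnv e) (there x) ⟩
    map₁ (wk Δ) (liftEnv e (there x))        ≡⟨ cong (map₁ (wk Δ)) (liftEnv-there e x) ⟩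
    map₁ (wk Δ) (map₁ there (e x))           ≡⟨ map-map (e x) ⟩
    map₁ (wk (σ ∷ Δ)) (e x)                  ∎
    where open ≡-Reasoning

  liftEnvₙ-bvar : ∀ {Ξ Γ' : Ctx {S}} {Θ} (Δ : List (Ty S)) (e : Env Ξ Γ' Θ) {τ} (j : Δ ∋ τ) →
                  liftEnvₙ Δ e (bvar Δ j) ≡ inj₁ (bvar Δ j)
  liftEnvₙ-bvar (σ ∷ Δ) e here      = liftEnvₙ-wk Δ (liftEnv e) here
  liftEnvₙ-bvar (σ ∷ Δ) e (there j) = liftEnvₙ-bvar Δ (liftEnv e) j

  split-wk : ∀ {Γ : Ctx {S}} (Δ : List (Ty S)) {τ} (y : Γ ∋ τ) → split Δ (wk Δ y) ≡ inj₁ y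
  split-wk []      y = refl
  split-wk (σ ∷ Δ) y rewrite split-wk Δ (there {τ = σ} y) = refl

  split-bvar : ∀ {Γ : Ctx {S}} (Δ : List (Ty S)) {τ} (j : Δ ∋ τ) →
               split {Γ = Γ} Δ (bvar Δ j) ≡ inj₂ j
  split-bvar {Γ} (σ ∷ Δ) here      rewrite split-wk {Γ = σ ∷ Γ} Δ here = refl
  split-bvar {Γ} (σ ∷ Δ) (there j) rewrite split-bvar {Γ = σ ∷ Γ} Δ j = refl

  split-liftₙ : ∀ {Γ Γ' : Ctx {S}} (Δ : List (Ty S)) (ρ : Ren Γ Γ') {τ} (x : (Γ ⧺ Δ) ∋ τ) →
                split Δ (liftₙ Δ ρ x) ≡ map₁ ρ (split Δ x)
  split-liftₙ {Γ} {Γ'} Δ ρ x with binderView Δ x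
  ... | weakened y
    rewrite liftₙ-wk Δ ρ y | split-wk {Γ = Γ'} Δ (ρ y) | split-wk {Γ = Γ} Δ y = refl
  ... | bound j
    rewrite liftₙ-bvar Δ ρ j | split-bvar {Γ = Γ'} Δ j | split-bvar {Γ = Γ} Δ j = refl

  Commutes : ∀ {Ξ₁ Γ₁ Ξ₂ Γ₂ : Ctx {S}} {Θ} →
             Env Ξ₁ Γ₁ Θ → Ren Ξ₂ Ξ₁ → Ren Γ₂ Γ₁ → Env Ξ₂ Γ₂ Θ → Set
  Commutes e₁ ρ₀ ρ e₂ = ∀ {τ} x → e₁ {τ} (ρ₀ x) ≡ map₁ ρ (e₂ x)

  Commutes-id : ∀ {Ξ₁ Ξ₂ Γ : Ctx {S}} {Θ} (e₁ : Env Ξ₁ Γ Θ) (ρ₀ : Ren Ξ₂ Ξ₁) {e₂ : Env Ξ₂ Γ Θ} →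
                (∀ {τ} (x : Ξ₂ ∋ τ) → e₁ (ρ₀ x) ≡ e₂ x) → Commutes e₁ ρ₀ id e₂
  Commutes-id e₁ ρ₀ {e₂} eq x = trans (eq x) (sym (map-id (e₂ x)))

  liftEnvₙ-commutes : ∀ {Ξ₁ Γ₁ Ξ₂ Γ₂ : Ctx {S}} {Θ} (Δ : List (Ty S))
                      {e₁ : Env Ξ₁ Γ₁ Θ} {ρ₀ : Ren Ξ₂ Ξ₁} {ρ : Ren Γ₂ Γ₁} {e₂ : Env Ξ₂ Γ₂ Θ} →
                      Commutes e₁ ρ₀ ρ e₂ →
                      Commutes (liftEnvₙ Δ e₁) (liftₙ Δ ρ₀) (liftₙ Δ ρ) (liftEnvₙ Δ e₂)
  liftEnvₙ-commutes Δ {e₁} {ρ₀} {ρ} {e₂} comm x with binderView Δ x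
  ... | bound j
    rewrite liftₙ-bvar Δ ρ₀ j | liftEnvₙ-bvar Δ e₁ j | liftEnvₙ-bvar Δ e₂ j =
      cong inj₁ (sym (liftₙ-bvar Δ ρ j))
  ... | weakened y
    rewrite liftₙ-wk Δ ρ₀ y | liftEnvₙ-wk Δ e₁ (ρ₀ y) | liftEnvₙ-wk Δ e₂ y | comm y with e₂ y
  ...   | inj₁ z = cong inj₁ (sym (liftₙ-wk Δ ρ z))
  ...   | inj₂ i = refl

  liftEnvₙ-keep : ∀ {Ξ : Ctx {S}} {Θ} (Δ : List (Ty S)) {e : Env Ξ Ξ Θ} →
                  (∀ {τ} (x : Ξ ∋ τ) → e x ≡ inj₁ x) →
                  ∀ {τ} (x : (Ξ ⧺ Δ) ∋ τ) → liftEnvₙ Δ e x ≡ inj₁ x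
  liftEnvₙ-keep Δ {e} keep x with binderView Δ x
  ... | weakened y rewrite liftEnvₙ-wk Δ e y | keep y = refl
  ... | bound j    = liftEnvₙ-bvar Δ e j

  Commutes-wk : ∀ {Ξ₁ Γ₁ Ξ₂ Γ₂ : Ctx {S}} {Θ} (Δ : List (Ty S))
                {e₁ : Env Ξ₁ Γ₁ Θ} {ρ₀ : Ren (Ξ₂ ⧺ Δ) Ξ₁} {ρ : Ren (Γ₂ ⧺ Δ) Γ₁} {e₂ : Env Ξ₂ Γ₂ Θ}
                {ρ' : Ren Γ₂ Γ₁} →
                Commutes e₁ ρ₀ ρ (liftEnvₙ Δ e₂) → (λ x → ρ (wk Δ x)) ≗ᴿ ρ' →
                Commutes e₁ (λ x → ρ₀ (wk Δ x)) ρ' e₂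
  Commutes-wk Δ {ρ = ρ} {e₂} {ρ'} comm ρ∘wk≗ρ' x = begin
    _                               ≡⟨ comm (wk Δ x) ⟩
    map₁ ρ (liftEnvₙ Δ e₂ (wk Δ x)) ≡⟨ cong (map₁ ρ) (liftEnvₙ-wk Δ e₂ x) ⟩
    map₁ ρ (map₁ (wk Δ) (e₂ x))     ≡⟨ map-map (e₂ x) ⟩
    map₁ (λ y → ρ (wk Δ y)) (e₂ x)  ≡⟨ map₁-cong ρ∘wk≗ρ' (e₂ x) ⟩
    map₁ ρ' (e₂ x)                  ∎
    where open ≡-Reasoning

  liftEnvₙ-resolve : ∀ {Ξ Γ' : Ctx {S}} {Θ} (Δ : List (Ty S))
                     {e : Env Ξ Γ' Θ} {f : Ren Θ Γ'} {ρ : Ren Ξ Γ'} →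
                     (∀ {τ} (x : Ξ ∋ τ) → [ id , f ]′ (e x) ≡ ρ x) →
                     ∀ {τ} (x : (Ξ ⧺ Δ) ∋ τ) →
                     [ id , (λ j → wk Δ (f j)) ]′ (liftEnvₙ Δ e x) ≡ liftₙ Δ ρ x
  liftEnvₙ-resolve Δ {e} {f} {ρ} res x with binderView Δ x
  ... | bound j rewrite liftEnvₙ-bvar Δ e j | liftₙ-bvar Δ ρ j = refl
  ... | weakened y rewrite liftEnvₙ-wk Δ e y | liftₙ-wk Δ ρ y | sym (res y) with e y
  ...   | inj₁ z = refl
  ...   | inj₂ i = refl

module _ {S : Set} (F : Ty S → Set) where

  renH-∘ : ∀ {Γ Γ' Γ'' τ} {ρ : Ren Γ' Γ''} {ρ' : Ren Γ Γ'} {ρ'' : Ren Γ Γ''} →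
           (λ x → ρ (ρ' x)) ≗ᴿ ρ'' → (h : Head F Γ τ) → renH F ρ (renH F ρ' h) ≡ renH F ρ'' h
  renH-∘ eq (var x) = cong var (eq x)
  renH-∘ eq (fun f) = refl

  renNe-∘ : ∀ {Γ Γ' Γ'' a} {ρ : Ren Γ' Γ''} {ρ' : Ren Γ Γ'} {ρ'' : Ren Γ Γ''} →
            (λ x → ρ (ρ' x)) ≗ᴿ ρ'' → (t : Ne F Γ a) → renNe F ρ (renNe F ρ' t) ≡ renNe F ρ'' t
  renArgs-∘ : ∀ {Γ Γ' Γ'' Θ} {ρ : Ren Γ' Γ''} {ρ' : Ren Γ Γ'} {ρ'' : Ren Γ Γ''} →
              (λ x → ρ (ρ' x)) ≗ᴿ ρ'' → (ts : Args F Γ Θ) →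
              renArgs F ρ (renArgs F ρ' ts) ≡ renArgs F ρ'' ts
  renNe-∘ eq (h $ us) = cong₂ _$_ (renH-∘ eq h) (renArgs-∘ eq us)
  renArgs-∘ eq []              = refl
  renArgs-∘ eq (_∷_ {Δ} u us) = cong₂ _∷_ (renNe-∘ (liftₙ-∘ Δ eq) u) (renArgs-∘ eq us)

  renH-id : ∀ {Γ τ} {ρ : Ren Γ Γ} → ρ ≗ᴿ id → (h : Head F Γ τ) → renH F ρ h ≡ h
  renH-id eq (var x) = cong var (eq x)
  renH-id eq (fun f) = refl

  renNe-id : ∀ {Γ a} {ρ : Ren Γ Γ} → ρ ≗ᴿ id → (t : Ne F Γ a) → renNe F ρ t ≡ t
  renArgs-id : ∀ {Γ Θ} {ρ : Ren Γ Γ} → ρ ≗ᴿ id → (ts : Args F Γ Θ) → renArgs F ρ ts ≡ ts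
  renNe-id eq (h $ us) = cong₂ _$_ (renH-id eq h) (renArgs-id eq us)
  renArgs-id eq []              = refl
  renArgs-id eq (_∷_ {Δ} u us) =
    cong₂ _∷_ (renNe-id (λ x → trans (liftₙ-cong Δ eq x) (liftₙ-id Δ x)) u) (renArgs-id eq us)

  renArgs-++ : ∀ {Γ Γ' Θ Ψ} (ρ : Ren Γ Γ') (xs : Args F Γ Θ) (ys : Args F Γ Ψ) →
               renArgs F ρ (_++ᴬ_ F xs ys) ≡ _++ᴬ_ F (renArgs F ρ xs) (renArgs F ρ ys)
  renArgs-++ ρ []       ys = refl
  renArgs-++ ρ (x ∷ xs) ys = cong (_ ∷_) (renArgs-++ ρ xs ys)

  renArgs-ηArgs : ∀ {Γ Γ'} (Δ : List (Ty S)) (ρ : Ren Γ Γ') {f : Ren Δ Γ} {g : Ren Δ Γ'} →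
                  (λ j → ρ (f j)) ≗ᴿ g → renArgs F ρ (ηArgs F Δ f) ≡ ηArgs F Δ g
  renArgs-ηArgs []             ρ eq = refl
  renArgs-ηArgs ((Δ' ⇒ b) ∷ Δ) ρ {f} eq =
    cong₂ _∷_
      (cong₂ _$_ (cong var (trans (liftₙ-wk Δ' ρ (f here)) (cong (wk Δ') (eq here))))
                 (renArgs-ηArgs Δ' (liftₙ Δ' ρ) (liftₙ-bvar Δ' ρ)))
      (renArgs-ηArgs Δ ρ (λ j → eq (there j)))

  record Partial (Γ : Ctx) (Z : List (Ty S)) (a : S) : Set where
    constructor _·_
    field
      {Θ}  : List (Ty S)
      head : Head F Γ ((Θ ++ Z) ⇒ a)
      args : Args F Γ Θ

  infixl 5 _$⁺_
  _$⁺_ : ∀ {Γ Z a} → Partial Γ Z a → Args F Γ Z → Ne F Γ a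
  (h · ts) $⁺ zs = h $ _++ᴬ_ F ts zs

  renP : ∀ {Γ Γ' Z a} → Ren Γ Γ' → Partial Γ Z a → Partial Γ' Z a
  renP ρ (h · ts) = renH F ρ h · renArgs F ρ ts

  renNe-$⁺ : ∀ {Γ Γ' Z a} (ρ : Ren Γ Γ') (p : Partial Γ Z a) (zs : Args F Γ Z) →
             renNe F ρ (p $⁺ zs) ≡ renP ρ p $⁺ renArgs F ρ zs
  renNe-$⁺ ρ (h · ts) zs = cong (renH F ρ h $_) (renArgs-++ ρ ts zs)

  renP-∘ : ∀ {Γ Γ' Γ'' Z a} {ρ : Ren Γ' Γ''} {ρ' : Ren Γ Γ'} {ρ'' : Ren Γ Γ''} →
           (λ x → ρ (ρ' x)) ≗ᴿ ρ'' → (p : Partial Γ Z a) → renP ρ (renP ρ' p) ≡ renP ρ'' p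
  renP-∘ eq (h · ts) = cong₂ _·_ (renH-∘ eq h) (renArgs-∘ eq ts)

  renP-id : ∀ {Γ Z a} (p : Partial Γ Z a) → renP id p ≡ p
  renP-id (h · ts) = cong₂ _·_ (renH-id (λ _ → refl) h) (renArgs-id (λ _ → refl) ts)

  expandedForm : ∀ {Γ Y a} → Partial Γ Y a → Ne F (Γ ⧺ Y) a
  expandedForm {Y = Y} p = renP (wk Y) p $⁺ ηArgs F Y (bvar Y)

  renNe-expandedForm : ∀ {Γ Γ' Y a} (ρ : Ren Γ Γ') (p : Partial Γ Y a) →
                       renNe F (liftₙ Y ρ) (expandedForm p) ≡ expandedForm (renP ρ p)
  renNe-expandedForm {Y = Y} ρ p = begin
    renNe F (liftₙ Y ρ) (expandedForm p)
      ≡⟨ renNe-$⁺ (liftₙ Y ρ) (renP (wk Y) p) (ηArgs F Y (bvar Y)) ⟩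
    renP (liftₙ Y ρ) (renP (wk Y) p) $⁺ renArgs F (liftₙ Y ρ) (ηArgs F Y (bvar Y))
      ≡⟨ cong₂ _$⁺_ wk-square (renArgs-ηArgs Y (liftₙ Y ρ) (liftₙ-bvar Y ρ)) ⟩
    expandedForm (renP ρ p)
      ∎
    where
    open ≡-Reasoning
    wk-square : renP (liftₙ Y ρ) (renP (wk Y) p) ≡ renP (wk Y) (renP ρ p)
    wk-square = trans (renP-∘ (liftₙ-wk Y ρ) p) (sym (renP-∘ (λ _ → refl) p))

  -- Substitution commutes with renaming

  subVar : ∀ {Γ'} (Θ : List (Ty S)) {Θ' a} → Args F Γ' Θ →
           (Γ' ∋ (Θ' ⇒ a)) ⊎ (Θ ∋ (Θ' ⇒ a)) → Args F Γ' Θ' → Ne F Γ' a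
  subVar Θ ts (inj₁ y) vs = var y $ vs
  subVar Θ ts (inj₂ i) vs = appl F Θ i ts vs

  subNe-var : ∀ {Ξ Γ'} (Θ : List (Ty S)) (e : Env Ξ Γ' Θ) (ts : Args F Γ' Θ) {Θ' a}
              (x : Ξ ∋ (Θ' ⇒ a)) (us : Args F Ξ Θ') →
              subNe F Θ e ts (var x $ us) ≡ subVar Θ ts (e x) (subArgs F Θ e ts us)
  subNe-var Θ e ts x us with e x
  ... | inj₁ y = refl
  ... | inj₂ i = refl

  subArgs-++ : ∀ {Ξ Γ'} (Θ : List (Ty S)) {A B} (e : Env Ξ Γ' Θ) (ts : Args F Γ' Θ)
               (xs : Args F Ξ A) (ys : Args F Ξ B) →
               subArgs F Θ e ts (_++ᴬ_ F xs ys)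
                 ≡ _++ᴬ_ F (subArgs F Θ e ts xs) (subArgs F Θ e ts ys)
  subArgs-++ Θ e ts []       ys = refl
  subArgs-++ Θ e ts (x ∷ xs) ys = cong (_ ∷_) (subArgs-++ Θ e ts xs ys)

  subNe-natural : ∀ {Ξ₁ Γ₁ Ξ₂ Γ₂} (Θ : List (Ty S)) {a}
                  {e₁ : Env Ξ₁ Γ₁ Θ} {ρ₀ : Ren Ξ₂ Ξ₁} {ρ : Ren Γ₂ Γ₁} {e₂ : Env Ξ₂ Γ₂ Θ}
                  {ts₁ : Args F Γ₁ Θ} {ts₂ : Args F Γ₂ Θ} →
                  ts₁ ≡ renArgs F ρ ts₂ → Commutes e₁ ρ₀ ρ e₂ → (t : Ne F Ξ₂ a) →
                  subNe F Θ e₁ ts₁ (renNe F ρ₀ t) ≡ renNe F ρ (subNe F Θ e₂ ts₂ t)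
  subArgs-natural : ∀ {Ξ₁ Γ₁ Ξ₂ Γ₂} (Θ : List (Ty S)) {Ψ}
                    {e₁ : Env Ξ₁ Γ₁ Θ} {ρ₀ : Ren Ξ₂ Ξ₁} {ρ : Ren Γ₂ Γ₁} {e₂ : Env Ξ₂ Γ₂ Θ}
                    {ts₁ : Args F Γ₁ Θ} {ts₂ : Args F Γ₂ Θ} →
                    ts₁ ≡ renArgs F ρ ts₂ → Commutes e₁ ρ₀ ρ e₂ → (us : Args F Ξ₂ Ψ) →
                    subArgs F Θ e₁ ts₁ (renArgs F ρ₀ us) ≡ renArgs F ρ (subArgs F Θ e₂ ts₂ us)
  renNe-appl : ∀ {Γ Γ'} (Θ : List (Ty S)) {Θ₁ b} (ρ : Ren Γ Γ') (i : Θ ∋ (Θ₁ ⇒ b))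
               (ts : Args F Γ Θ) (vs : Args F Γ Θ₁) →
               renNe F ρ (appl F Θ i ts vs) ≡ appl F Θ i (renArgs F ρ ts) (renArgs F ρ vs)
  subVar-natural : ∀ {Γ Γ'} (Θ : List (Ty S)) {Θ' a} (ρ : Ren Γ Γ') (ts : Args F Γ Θ)
                   (z : (Γ ∋ (Θ' ⇒ a)) ⊎ (Θ ∋ (Θ' ⇒ a))) (vs : Args F Γ Θ') →
                   subVar Θ (renArgs F ρ ts) (map₁ ρ z) (renArgs F ρ vs)
                     ≡ renNe F ρ (subVar Θ ts z vs)

  subNe-natural Θ ts≡ comm (fun f $ us) = cong (fun f $_) (subArgs-natural Θ ts≡ comm us)
  subNe-natural Θ {e₁ = e₁} {ρ₀} {ρ} {e₂} {ts₁} {ts₂} refl comm (var x $ us) = begin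
    subNe F Θ e₁ ts₁ (var (ρ₀ x) $ renArgs F ρ₀ us)
      ≡⟨ subNe-var Θ e₁ ts₁ (ρ₀ x) (renArgs F ρ₀ us) ⟩
    subVar Θ ts₁ (e₁ (ρ₀ x)) (subArgs F Θ e₁ ts₁ (renArgs F ρ₀ us))
      ≡⟨ cong₂ (subVar Θ ts₁) (comm x) (subArgs-natural Θ refl comm us) ⟩
    subVar Θ ts₁ (map₁ ρ (e₂ x)) (renArgs F ρ (subArgs F Θ e₂ ts₂ us))
      ≡⟨ subVar-natural Θ ρ ts₂ (e₂ x) (subArgs F Θ e₂ ts₂ us) ⟩
    renNe F ρ (subVar Θ ts₂ (e₂ x) (subArgs F Θ e₂ ts₂ us))
      ≡⟨ cong (renNe F ρ) (sym (subNe-var Θ e₂ ts₂ x us)) ⟩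
    renNe F ρ (subNe F Θ e₂ ts₂ (var x $ us))
      ∎
    where open ≡-Reasoning
  subArgs-natural Θ ts≡ comm [] = refl
  subArgs-natural Θ {ρ = ρ} {ts₁ = ts₁} {ts₂} ts≡ comm (_∷_ {Δ} u us) =
    cong₂ _∷_ (subNe-natural Θ wk-ts≡ (liftEnvₙ-commutes Δ comm) u)
              (subArgs-natural Θ ts≡ comm us)
    where
    wk-ts≡ : renArgs F (wk Δ) ts₁ ≡ renArgs F (liftₙ Δ ρ) (renArgs F (wk Δ) ts₂)
    wk-ts≡ = trans (cong (renArgs F (wk Δ)) ts≡)
                   (trans (renArgs-∘ (λ _ → refl) ts₂) (sym (renArgs-∘ (liftₙ-wk Δ ρ) ts₂)))

  renNe-appl ((Θ₁ ⇒ b) ∷ Θ) ρ here (w ∷ ts) vs =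
    sym (subNe-natural Θ₁ refl (split-liftₙ Θ₁ ρ) w)
  renNe-appl (_ ∷ Θ) ρ (there i) (_ ∷ ts) vs = renNe-appl Θ ρ i ts vs

  subVar-natural Θ ρ ts (inj₁ y) vs = refl
  subVar-natural Θ ρ ts (inj₂ i) vs = sym (renNe-appl Θ ρ i ts vs)

  subNe-renNe : ∀ {Ξ₁ Ξ₂ Γ} (Θ : List (Ty S)) {a}
                {e₁ : Env Ξ₁ Γ Θ} {ρ₀ : Ren Ξ₂ Ξ₁} {e₂ : Env Ξ₂ Γ Θ} (ts : Args F Γ Θ) →
                (∀ {τ} (x : Ξ₂ ∋ τ) → e₁ (ρ₀ x) ≡ e₂ x) →
                (t : Ne F Ξ₂ a) → subNe F Θ e₁ ts (renNe F ρ₀ t) ≡ subNe F Θ e₂ ts t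
  subNe-renNe Θ {e₁ = e₁} {ρ₀} ts eq t =
    trans (subNe-natural Θ (sym (renArgs-id (λ _ → refl) ts)) (Commutes-id e₁ ρ₀ eq) t)
          (renNe-id (λ _ → refl) _)

  subArgs-renArgs : ∀ {Ξ₁ Ξ₂ Γ} (Θ : List (Ty S)) {Ψ}
                    {e₁ : Env Ξ₁ Γ Θ} {ρ₀ : Ren Ξ₂ Ξ₁} {e₂ : Env Ξ₂ Γ Θ} (ts : Args F Γ Θ) →
                    (∀ {τ} (x : Ξ₂ ∋ τ) → e₁ (ρ₀ x) ≡ e₂ x) →
                    (us : Args F Ξ₂ Ψ) → subArgs F Θ e₁ ts (renArgs F ρ₀ us) ≡ subArgs F Θ e₂ ts us
  subArgs-renArgs Θ {e₁ = e₁} {ρ₀} ts eq us =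
    trans (subArgs-natural Θ (sym (renArgs-id (λ _ → refl) ts)) (Commutes-id e₁ ρ₀ eq) us)
          (renArgs-id (λ _ → refl) _)

  subNe-keep : ∀ {Ξ} (Θ : List (Ty S)) {a} {e : Env Ξ Ξ Θ} (ts : Args F Ξ Θ) →
               (∀ {τ} (x : Ξ ∋ τ) → e x ≡ inj₁ x) → (t : Ne F Ξ a) → subNe F Θ e ts t ≡ t
  subArgs-keep : ∀ {Ξ} (Θ : List (Ty S)) {Ψ} {e : Env Ξ Ξ Θ} (ts : Args F Ξ Θ) →
                 (∀ {τ} (x : Ξ ∋ τ) → e x ≡ inj₁ x) → (us : Args F Ξ Ψ) → subArgs F Θ e ts us ≡ us
  subNe-keep Θ ts keep (fun f $ us) = cong (fun f $_) (subArgs-keep Θ ts keep us)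
  subNe-keep Θ {e = e} ts keep (var x $ us)
    rewrite subNe-var Θ e ts x us | keep x = cong (var x $_) (subArgs-keep Θ ts keep us)
  subArgs-keep Θ ts keep []              = refl
  subArgs-keep Θ ts keep (_∷_ {Δ} u us) =
    cong₂ _∷_ (subNe-keep Θ _ (liftEnvₙ-keep Δ keep) u) (subArgs-keep Θ ts keep us)

  -- η-expanded variables are units of substitution

  lookupArgs : ∀ {Γ Θ Δ b} → Args F Γ Θ → Θ ∋ (Δ ⇒ b) → Ne F (Γ ⧺ Δ) b
  lookupArgs (w ∷ ts) here      = w
  lookupArgs (w ∷ ts) (there i) = lookupArgs ts i

  selectArgs : ∀ {Γ Θ} (Δ : List (Ty S)) → Args F Γ Θ → Ren Δ Θ → Args F Γ Δ
  selectArgs []             vs π = []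
  selectArgs ((Δ' ⇒ b) ∷ Δ) vs π = lookupArgs vs (π here) ∷ selectArgs Δ vs (λ j → π (there j))

  selectArgs-there : ∀ {Γ Θ Δ₀ b₀} (Δ : List (Ty S)) (w : Ne F (Γ ⧺ Δ₀) b₀) (vs : Args F Γ Θ)
                     (π : Ren Δ Θ) →
                     selectArgs Δ (_∷_ {Δ = Δ₀} w vs) (λ j → there (π j)) ≡ selectArgs Δ vs π
  selectArgs-there []             w vs π = refl
  selectArgs-there ((Δ' ⇒ b) ∷ Δ) w vs π = cong (_ ∷_) (selectArgs-there Δ w vs (λ j → π (there j)))

  selectArgs-id : ∀ {Γ Θ} (vs : Args F Γ Θ) → selectArgs Θ vs id ≡ vs
  selectArgs-id []       = refl
  selectArgs-id (w ∷ vs) = cong (w ∷_) (trans (selectArgs-there _ w vs id) (selectArgs-id vs))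

  subArgs-ηArgs-keep : ∀ {Ξ Γ'} (Θ : List (Ty S)) (e : Env Ξ Γ' Θ) (ts : Args F Γ' Θ)
                       (Δ : List (Ty S)) {f : Ren Δ Ξ} {g : Ren Δ Γ'} →
                       (∀ {τ} (j : Δ ∋ τ) → e (f j) ≡ inj₁ (g j)) →
                       subArgs F Θ e ts (ηArgs F Δ f) ≡ ηArgs F Δ g
  subArgs-ηArgs-keep Θ e ts []             eq = refl
  subArgs-ηArgs-keep Θ e ts ((Δ' ⇒ b) ∷ Δ) {f} eq =
    cong₂ _∷_
      (trans (subNe-var Θ (liftEnvₙ Δ' e) _ (wk Δ' (f here)) (ηArgs F Δ' (bvar Δ')))
        (cong₂ (subVar Θ (renArgs F (wk Δ') ts))
          (trans (liftEnvₙ-wk Δ' e (f here)) (cong (map₁ (wk Δ')) (eq here)))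
          (subArgs-ηArgs-keep Θ (liftEnvₙ Δ' e) _ Δ' (liftEnvₙ-bvar Δ' e))))
      (subArgs-ηArgs-keep Θ e ts Δ (λ j → eq (there j)))

  subNe-ηArgs : ∀ {Ξ Γ'} (Θ : List (Ty S)) {a} {e : Env Ξ Γ' Θ} {f : Ren Θ Γ'} {ts : Args F Γ' Θ}
                {ρ : Ren Ξ Γ'} → ts ≡ ηArgs F Θ f →
                (∀ {τ} (x : Ξ ∋ τ) → [ id , f ]′ (e x) ≡ ρ x) →
                (t : Ne F Ξ a) → subNe F Θ e ts t ≡ renNe F ρ t
  subArgs-ηArgs : ∀ {Ξ Γ'} (Θ : List (Ty S)) {Ψ} {e : Env Ξ Γ' Θ} {f : Ren Θ Γ'} {ts : Args F Γ' Θ}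
                  {ρ : Ren Ξ Γ'} → ts ≡ ηArgs F Θ f →
                  (∀ {τ} (x : Ξ ∋ τ) → [ id , f ]′ (e x) ≡ ρ x) →
                  (us : Args F Ξ Ψ) → subArgs F Θ e ts us ≡ renArgs F ρ us
  subVar-ηArgs : ∀ {Γ} (Θ : List (Ty S)) {Θ' a} (f : Ren Θ Γ)
                 (z : (Γ ∋ (Θ' ⇒ a)) ⊎ (Θ ∋ (Θ' ⇒ a))) (vs : Args F Γ Θ') →
                 subVar Θ (ηArgs F Θ f) z vs ≡ var ([ id , f ]′ z) $ vs
  appl-ηArgs : ∀ {Γ} (Θ : List (Ty S)) {Θ₁ b} (f : Ren Θ Γ) (i : Θ ∋ (Θ₁ ⇒ b)) (vs : Args F Γ Θ₁) →
               appl F Θ i (ηArgs F Θ f) vs ≡ var (f i) $ vs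
  subArgs-ηArgs-select : ∀ {Ξ Γ'} (Θ : List (Ty S)) (e : Env Ξ Γ' Θ) (vs : Args F Γ' Θ)
                         (Δ : List (Ty S)) {g : Ren Δ Ξ} {π : Ren Δ Θ} →
                         (∀ {τ} (j : Δ ∋ τ) → e (g j) ≡ inj₂ (π j)) →
                         subArgs F Θ e vs (ηArgs F Δ g) ≡ selectArgs Δ vs π
  appl-ηArgs-lookup : ∀ {Γ} (Θ : List (Ty S)) {Δ b} (k : Θ ∋ (Δ ⇒ b)) (vs : Args F Γ Θ) →
                      appl F Θ k (renArgs F (wk Δ) vs) (ηArgs F Δ (bvar Δ)) ≡ lookupArgs vs k

  subNe-ηArgs Θ ts≡ res (fun g $ us) = cong (fun g $_) (subArgs-ηArgs Θ ts≡ res us)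
  subNe-ηArgs Θ {e = e} {f} {ρ = ρ} refl res (var x $ us) = begin
    subNe F Θ e (ηArgs F Θ f) (var x $ us)
      ≡⟨ subNe-var Θ e _ x us ⟩
    subVar Θ (ηArgs F Θ f) (e x) (subArgs F Θ e (ηArgs F Θ f) us)
      ≡⟨ cong (subVar Θ (ηArgs F Θ f) (e x)) (subArgs-ηArgs Θ refl res us) ⟩
    subVar Θ (ηArgs F Θ f) (e x) (renArgs F ρ us)
      ≡⟨ subVar-ηArgs Θ f (e x) (renArgs F ρ us) ⟩
    var ([ id , f ]′ (e x)) $ renArgs F ρ us
      ≡⟨ cong (λ y → var y $ renArgs F ρ us) (res x) ⟩
    var (ρ x) $ renArgs F ρ us
      ∎
    where open ≡-Reasoning
  subArgs-ηArgs Θ ts≡ res []              = refl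
  subArgs-ηArgs Θ {f = f} {ts} ts≡ res (_∷_ {Δ} u us) =
    cong₂ _∷_
      (subNe-ηArgs Θ wk-ts≡ (liftEnvₙ-resolve Δ res) u)
      (subArgs-ηArgs Θ ts≡ res us)
    where
    wk-ts≡ : renArgs F (wk Δ) ts ≡ ηArgs F Θ (λ j → wk Δ (f j))
    wk-ts≡ = trans (cong (renArgs F (wk Δ)) ts≡) (renArgs-ηArgs Θ (wk Δ) (λ _ → refl))

  subVar-ηArgs Θ f (inj₁ y) vs = refl
  subVar-ηArgs Θ f (inj₂ i) vs = appl-ηArgs Θ f i vs

  appl-ηArgs ((Θ₁ ⇒ b) ∷ Θ) f here vs = begin
    subNe F Θ₁ (split Θ₁) vs (var (wk Θ₁ (f here)) $ ηArgs F Θ₁ (bvar Θ₁))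
      ≡⟨ subNe-var Θ₁ (split Θ₁) vs (wk Θ₁ (f here)) (ηArgs F Θ₁ (bvar Θ₁)) ⟩
    subVar Θ₁ vs (split Θ₁ (wk Θ₁ (f here))) (subArgs F Θ₁ (split Θ₁) vs (ηArgs F Θ₁ (bvar Θ₁)))
      ≡⟨ cong₂ (subVar Θ₁ vs) (split-wk Θ₁ (f here))
                              (subArgs-ηArgs-select Θ₁ (split Θ₁) vs Θ₁ (split-bvar Θ₁)) ⟩
    var (f here) $ selectArgs Θ₁ vs id
      ≡⟨ cong (var (f here) $_) (selectArgs-id vs) ⟩
    var (f here) $ vs
      ∎
    where open ≡-Reasoning
  appl-ηArgs ((_ ⇒ _) ∷ Θ) f (there i) vs = appl-ηArgs Θ (λ j → f (there j)) i vs

  subArgs-ηArgs-select Θ e vs []             eq = refl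
  subArgs-ηArgs-select Θ e vs ((Δ' ⇒ b) ∷ Δ) {g} {π} eq =
    cong₂ _∷_
      (trans (subNe-var Θ (liftEnvₙ Δ' e) _ (wk Δ' (g here)) (ηArgs F Δ' (bvar Δ')))
        (trans (cong₂ (subVar Θ (renArgs F (wk Δ') vs))
                  (trans (liftEnvₙ-wk Δ' e (g here)) (cong (map₁ (wk Δ')) (eq here)))
                  (subArgs-ηArgs-keep Θ (liftEnvₙ Δ' e) _ Δ' (liftEnvₙ-bvar Δ' e)))
          (appl-ηArgs-lookup Θ (π here) vs)))
      (subArgs-ηArgs-select Θ e vs Δ (λ j → eq (there j)))

  appl-ηArgs-lookup {Γ} ((Δ ⇒ b) ∷ Θ) here (w ∷ vs) =
    trans (subNe-renNe Δ _ (λ _ → refl) w)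
          (trans (subNe-ηArgs Δ refl resolve w) (renNe-id (λ _ → refl) w))
    where
    resolve : ∀ {τ} (x : (Γ ⧺ Δ) ∋ τ) → [ id , bvar Δ ]′ (split Δ (liftₙ Δ (wk Δ) x)) ≡ x
    resolve x with binderView Δ x
    ... | weakened y rewrite liftₙ-wk Δ (wk Δ) y | split-wk {Γ = Γ ⧺ Δ} Δ (wk Δ y) = refl
    ... | bound j    rewrite liftₙ-bvar {Γ = Γ} Δ (wk Δ) j | split-bvar {Γ = Γ ⧺ Δ} Δ j = refl
  appl-ηArgs-lookup (_ ∷ Θ) (there k) (w ∷ vs) = appl-ηArgs-lookup Θ k vs

  lookupArgs-renArgs : ∀ {Γ Γ' Θ Δ b} (ρ : Ren Γ Γ') (ts : Args F Γ Θ) (i : Θ ∋ (Δ ⇒ b)) →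
                       lookupArgs (renArgs F ρ ts) i ≡ renNe F (liftₙ Δ ρ) (lookupArgs ts i)
  lookupArgs-renArgs ρ (w ∷ ts) here      = refl
  lookupArgs-renArgs ρ (w ∷ ts) (there i) = lookupArgs-renArgs ρ ts i

  appl-lookupArgs : ∀ {Γ} (Θ : List (Ty S)) {Δ b} (i : Θ ∋ (Δ ⇒ b)) (ts : Args F Γ Θ)
                    (vs : Args F Γ Δ) → appl F Θ i ts vs ≡ subNe F Δ (split Δ) vs (lookupArgs ts i)
  appl-lookupArgs ((Δ ⇒ b) ∷ Θ) here      (w ∷ ts) vs = refl
  appl-lookupArgs ((_ ⇒ _) ∷ Θ) (there i) (w ∷ ts) vs = appl-lookupArgs Θ i ts vs

  subNe-split-expandedForm : ∀ {Γ Y a} (p : Partial Γ Y a) (as : Args F Γ Y) →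
                             subNe F Y (split Y) as (expandedForm p) ≡ p $⁺ as
  subNe-split-expandedForm {Γ} {Y} {a} (h · ts) as = begin
    subNe F Y (split Y) as (renH F (wk Y) h $ _++ᴬ_ F (renArgs F (wk Y) ts) (ηArgs F Y (bvar Y)))
      ≡⟨ subNe-wk-head h ⟩
    h $ subArgs F Y (split Y) as (_++ᴬ_ F (renArgs F (wk Y) ts) (ηArgs F Y (bvar Y)))
      ≡⟨ cong (h $_) (subArgs-++ Y (split Y) as (renArgs F (wk Y) ts) (ηArgs F Y (bvar Y))) ⟩
    h $ _++ᴬ_ F (subArgs F Y (split Y) as (renArgs F (wk Y) ts))
                (subArgs F Y (split Y) as (ηArgs F Y (bvar Y)))
      ≡⟨ cong (h $_) (cong₂ (_++ᴬ_ F) args-unchanged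
                                       (subArgs-ηArgs-select Y (split Y) as Y (split-bvar Y))) ⟩
    h $ _++ᴬ_ F ts (selectArgs Y as id)
      ≡⟨ cong (λ vs → h $ _++ᴬ_ F ts vs) (selectArgs-id as) ⟩
    h $ _++ᴬ_ F ts as
      ∎
    where
    open ≡-Reasoning
    subNe-wk-head : ∀ {Ψ} (h : Head F Γ (Ψ ⇒ a)) {us : Args F (Γ ⧺ Y) Ψ} →
                    subNe F Y (split Y) as (renH F (wk Y) h $ us) ≡ h $ subArgs F Y (split Y) as us
    subNe-wk-head (fun f) = refl
    subNe-wk-head (var x) {us} =
      trans (subNe-var Y (split Y) as (wk Y x) us)
            (cong (λ z → subVar Y as z (subArgs F Y (split Y) as us)) (split-wk Y x))
    args-unchanged : subArgs F Y (split Y) as (renArgs F (wk Y) ts) ≡ ts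
    args-unchanged =
      trans (subArgs-renArgs Y as (split-wk Y) ts) (subArgs-keep Y as (λ _ → refl) ts)

  appl-expanded : ∀ {Γ Γ'} (Θ : List (Ty S)) {Y a} (ρ : Ren Γ Γ') (θ : Args F Γ Θ)
                  (i : Θ ∋ (Y ⇒ a)) (p : Partial Γ Y a) → lookupArgs θ i ≡ expandedForm p →
                  (as : Args F Γ' Y) → appl F Θ i (renArgs F ρ θ) as ≡ renP ρ p $⁺ as
  appl-expanded Θ {Y} ρ θ i p θᵢ≡ as = begin
    appl F Θ i (renArgs F ρ θ) as
      ≡⟨ appl-lookupArgs Θ i (renArgs F ρ θ) as ⟩
    subNe F Y (split Y) as (lookupArgs (renArgs F ρ θ) i)
      ≡⟨ cong (subNe F Y (split Y) as) (lookupArgs-renArgs ρ θ i) ⟩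
    subNe F Y (split Y) as (renNe F (liftₙ Y ρ) (lookupArgs θ i))
      ≡⟨ cong (λ w → subNe F Y (split Y) as (renNe F (liftₙ Y ρ) w)) θᵢ≡ ⟩
    subNe F Y (split Y) as (renNe F (liftₙ Y ρ) (expandedForm p))
      ≡⟨ cong (subNe F Y (split Y) as) (renNe-expandedForm ρ p) ⟩
    subNe F Y (split Y) as (expandedForm (renP ρ p))
      ≡⟨ subNe-split-expandedForm (renP ρ p) as ⟩
    renP ρ p $⁺ as
      ∎
    where open ≡-Reasoning

  AllExpanded-renArgs : ∀ {Γ Γ' Θ} (ρ : Ren Γ Γ') (ts : Args F Γ Θ) →
                        AllExpanded F ts → AllExpanded F (renArgs F ρ ts)
  AllExpanded-renArgs ρ []              _ = _
  AllExpanded-renArgs ρ (_∷_ {Δ} u us) ((_ , h , ts , u≡) , us-exp) =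
    (_ , renH F ρ h , renArgs F ρ ts ,
     trans (cong (renNe F (liftₙ Δ ρ)) u≡) (renNe-expandedForm ρ (h · ts))) ,
    AllExpanded-renArgs ρ us us-exp

  AllExpanded-lookupArgs : ∀ {Γ Θ Δ b} (ts : Args F Γ Θ) (i : Θ ∋ (Δ ⇒ b)) → AllExpanded F ts →
                           Σ[ p ∈ Partial Γ Δ b ] lookupArgs ts i ≡ expandedForm p
  AllExpanded-lookupArgs (w ∷ ts) here      ((_ , h , us , w≡) , _) = h · us , w≡
  AllExpanded-lookupArgs (w ∷ ts) (there i) (_ , ts-exp) = AllExpanded-lookupArgs ts i ts-exp

  ++ᴬ-assoc : ∀ {Γ} (A B C : List (Ty S)) (xs : Args F Γ A) (ys : Args F Γ B) (zs : Args F Γ C) →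
              subst (Args F Γ) (++-assoc A B C) (_++ᴬ_ F (_++ᴬ_ F xs ys) zs)
                ≡ _++ᴬ_ F xs (_++ᴬ_ F ys zs)
  ++ᴬ-assoc []             B C []       ys zs = refl
  ++ᴬ-assoc ((Δ ⇒ b) ∷ A) B C (x ∷ xs) ys zs = begin
    subst (Args F _) (cong ((Δ ⇒ b) ∷_) (++-assoc A B C)) (x ∷ _++ᴬ_ F (_++ᴬ_ F xs ys) zs)
      ≡⟨ subst-∷ (++-assoc A B C) ⟩
    x ∷ subst (Args F _) (++-assoc A B C) (_++ᴬ_ F (_++ᴬ_ F xs ys) zs)
      ≡⟨ cong (x ∷_) (++ᴬ-assoc A B C xs ys zs) ⟩
    x ∷ _++ᴬ_ F xs (_++ᴬ_ F ys zs)
      ∎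
    where
    open ≡-Reasoning
    subst-∷ : ∀ {L₁ L₂} (eq : L₁ ≡ L₂) {as : Args F _ L₁} →
              subst (Args F _) (cong ((Δ ⇒ b) ∷_) eq) (x ∷ as) ≡ x ∷ subst (Args F _) eq as
    subst-∷ refl = refl

  infixl 6 _·⁺_
  _·⁺_ : ∀ {Γ Ψ Z a} → Partial Γ (Ψ ++ Z) a → Args F Γ Ψ → Partial Γ Z a
  _·⁺_ {Γ} {Ψ} {Z} {a} (_·_ {Θs} h rs) us =
    subst (λ L → Head F Γ (L ⇒ a)) (sym (++-assoc Θs Ψ Z)) h · _++ᴬ_ F rs us

  ·⁺-$⁺ : ∀ {Γ Ψ Z a} (q : Partial Γ (Ψ ++ Z) a) (us : Args F Γ Ψ) (zs : Args F Γ Z) →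
          (q ·⁺ us) $⁺ zs ≡ q $⁺ _++ᴬ_ F us zs
  ·⁺-$⁺ {Γ} {Ψ} {Z} {a} (_·_ {Θs} h rs) us zs =
    subst-$ (++-assoc Θs Ψ Z) (++ᴬ-assoc Θs Ψ Z rs us zs)
    where
    subst-$ : ∀ {L₁ L₂} (eq : L₁ ≡ L₂) {h : Head F Γ (L₂ ⇒ a)} {as₁ : Args F Γ L₁} {as₂} →
              subst (Args F Γ) eq as₁ ≡ as₂ →
              subst (λ L → Head F Γ (L ⇒ a)) (sym eq) h $ as₁ ≡ h $ as₂
    subst-$ refl refl = refl

  renP-·⁺ : ∀ {Γ Γ' Ψ Z a} (ρ : Ren Γ Γ') (q : Partial Γ (Ψ ++ Z) a) (us : Args F Γ Ψ) →
            renP ρ (q ·⁺ us) ≡ renP ρ q ·⁺ renArgs F ρ us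
  renP-·⁺ {Γ} {Γ'} {Ψ} {Z} {a} ρ (_·_ {Θs} h rs) us =
    cong₂ _·_ (renH-subst (sym (++-assoc Θs Ψ Z))) (renArgs-++ ρ rs us)
    where
    renH-subst : ∀ {L₁ L₂} (eq : L₁ ≡ L₂) {h : Head F Γ (L₁ ⇒ a)} →
                 renH F ρ (subst (λ L → Head F Γ (L ⇒ a)) eq h)
                   ≡ subst (λ L → Head F Γ' (L ⇒ a)) eq (renH F ρ h)
    renH-subst refl = refl

  module _ {Ξ Γ'} {Θ : List (Ty S)} (E : Env Ξ Γ' Θ) (θ : Args F Γ' Θ) where

    -- Uniformity in ρ₀ and ρ lets p ↝ p* be used both at the root of v and at the end of a
    -- subterm path in u, below further binders.
    infix 4 _↝_
    _↝_ : ∀ {Z a} → Partial Ξ Z a → Partial Γ' Z a → Set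
    _↝_ {Z} p p* =
      ∀ {Ξ₁ Γ₁} {e₁ : Env Ξ₁ Γ₁ Θ} {ρ₀ : Ren Ξ Ξ₁} {ρ : Ren Γ' Γ₁} {ts₁ : Args F Γ₁ Θ} →
      ts₁ ≡ renArgs F ρ θ → Commutes e₁ ρ₀ ρ E → (zs : Args F Ξ₁ Z) →
      subNe F Θ e₁ ts₁ (renP ρ₀ p $⁺ zs) ≡ renP ρ p* $⁺ subArgs F Θ e₁ ts₁ zs

    subArgs-++-natural :
      ∀ {Ξ₁ Γ₁ Ψ Z} {e₁ : Env Ξ₁ Γ₁ Θ} {ρ₀ : Ren Ξ Ξ₁} {ρ : Ren Γ' Γ₁} {ts₁ : Args F Γ₁ Θ} →
      ts₁ ≡ renArgs F ρ θ → Commutes e₁ ρ₀ ρ E → (us : Args F Ξ Ψ) (zs : Args F Ξ₁ Z) →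
      subArgs F Θ e₁ ts₁ (_++ᴬ_ F (renArgs F ρ₀ us) zs)
        ≡ _++ᴬ_ F (renArgs F ρ (subArgs F Θ E θ us)) (subArgs F Θ e₁ ts₁ zs)
    subArgs-++-natural ts₁≡ comm us zs =
      trans (subArgs-++ Θ _ _ (renArgs F _ us) zs)
            (cong (λ vs → _++ᴬ_ F vs _) (subArgs-natural Θ ts₁≡ comm us))

    ↝-fun : ∀ {Ψ Z a} (f : F ((Ψ ++ Z) ⇒ a)) (us : Args F Ξ Ψ) →
            (fun f · us) ↝ (fun f · subArgs F Θ E θ us)
    ↝-fun f us ts₁≡ comm zs = cong (fun f $_) (subArgs-++-natural ts₁≡ comm us zs)

    ↝-kept : ∀ {Ψ Z a} {x : Ξ ∋ ((Ψ ++ Z) ⇒ a)} {y} → E x ≡ inj₁ y → (us : Args F Ξ Ψ) →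
             (var x · us) ↝ (var y · subArgs F Θ E θ us)
    ↝-kept {x = x} Ex us {e₁ = e₁} {ρ₀} {ts₁ = ts₁} ts₁≡ comm zs =
      trans (subNe-var Θ e₁ ts₁ (ρ₀ x) _)
            (cong₂ (subVar Θ ts₁) (trans (comm x) (cong (map₁ _) Ex))
                                  (subArgs-++-natural ts₁≡ comm us zs))

    ↝-expanded : ∀ {Ψ Z a} {x : Ξ ∋ ((Ψ ++ Z) ⇒ a)} {i} → E x ≡ inj₂ i →
                 (q : Partial Γ' (Ψ ++ Z) a) → lookupArgs θ i ≡ expandedForm q → (us : Args F Ξ Ψ) →
                 (var x · us) ↝ (q ·⁺ subArgs F Θ E θ us)
    ↝-expanded {x = x} {i} Ex q θᵢ≡ us {e₁ = e₁} {ρ₀} {ρ} {ts₁} refl comm zs = begin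
      subNe F Θ e₁ ts₁ (var (ρ₀ x) $ _++ᴬ_ F (renArgs F ρ₀ us) zs)
        ≡⟨ subNe-var Θ e₁ ts₁ (ρ₀ x) _ ⟩
      subVar Θ ts₁ (e₁ (ρ₀ x)) (subArgs F Θ e₁ ts₁ (_++ᴬ_ F (renArgs F ρ₀ us) zs))
        ≡⟨ cong₂ (subVar Θ ts₁) (trans (comm x) (cong (map₁ ρ) Ex))
                                (subArgs-++-natural refl comm us zs) ⟩
      appl F Θ i (renArgs F ρ θ) (_++ᴬ_ F us* zs*)
        ≡⟨ appl-expanded Θ ρ θ i q θᵢ≡ _ ⟩
      renP ρ q $⁺ _++ᴬ_ F us* zs*
        ≡⟨ sym (·⁺-$⁺ (renP ρ q) us* zs*) ⟩
      (renP ρ q ·⁺ us*) $⁺ zs*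
        ≡⟨ cong (_$⁺ zs*) (sym (renP-·⁺ ρ q (subArgs F Θ E θ us))) ⟩
      renP ρ (q ·⁺ subArgs F Θ E θ us) $⁺ zs*
        ∎
      where
      open ≡-Reasoning
      us* = renArgs F ρ (subArgs F Θ E θ us)
      zs* = subArgs F Θ e₁ ts₁ zs

    ↝-expandedForm : ∀ {Z a} {p : Partial Ξ Z a} {p*} → p ↝ p* →
                     subNe F Θ (liftEnvₙ Z E) (renArgs F (wk Z) θ) (expandedForm p)
                       ≡ expandedForm p*
    ↝-expandedForm {Z} {p* = p*} p↝p* =
      trans (p↝p* refl (liftEnvₙ-wk Z E) (ηArgs F Z (bvar Z)))
            (cong (renP (wk Z) p* $⁺_) (subArgs-ηArgs-keep Θ _ _ Z (liftEnvₙ-bvar Z E)))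

    substPartial : AllExpanded F θ → ∀ {Z a} (p : Partial Ξ Z a) → Σ[ p* ∈ Partial Γ' Z a ] p ↝ p*
    substPartial θ-exp (fun f · us) = _ , ↝-fun f us
    substPartial θ-exp (var x · us) with E x in Ex
    ... | inj₁ y = _ , ↝-kept Ex us
    ... | inj₂ i with AllExpanded-lookupArgs θ i θ-exp
    ...   | q , θᵢ≡ = _ , ↝-expanded Ex q θᵢ≡ us

  -- Subterm paths under substitution

  subNe-head : ∀ {Ξ Γ'} (Θ : List (Ty S)) (e : Env Ξ Γ' Θ) (θ : Args F Γ' Θ) → AllExpanded F θ →
               ∀ {Ψ c} (h : Head F Ξ (Ψ ⇒ c)) (us : Args F Ξ Ψ) →
               Σ[ p ∈ Partial Γ' Ψ c ] subNe F Θ e θ (h $ us) ≡ p $⁺ subArgs F Θ e θ us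
  subNe-head Θ e θ θ-exp h us with substPartial e θ θ-exp (h · [])
  ... | p* , h↝p* =
    renP id p* ,
    trans (cong (λ p → subNe F Θ e θ (p $⁺ us)) (sym (renP-id (h · []))))
          (h↝p* (sym (renArgs-id (λ _ → refl) θ)) (Commutes-id e id (λ _ → refl)) us)

  ArgIn-subArgs : ∀ {Ξ Γ'} (Θ : List (Ty S)) (e : Env Ξ Γ' Θ) (θ : Args F Γ' Θ) {Ψ Δ b}
                  {u : Ne F (Ξ ⧺ Δ) b} {us : Args F Ξ Ψ} → ArgIn F Δ u us →
                  ArgIn F Δ (subNe F Θ (liftEnvₙ Δ e) (renArgs F (wk Δ) θ) u) (subArgs F Θ e θ us)
  ArgIn-subArgs Θ e θ here      = here
  ArgIn-subArgs Θ e θ (there a) = there (ArgIn-subArgs Θ e θ a)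

  ArgIn-++ʳ : ∀ {Γ A B Δ b} {u : Ne F (Γ ⧺ Δ) b} (xs : Args F Γ A) {ys : Args F Γ B} →
              ArgIn F Δ u ys → ArgIn F Δ u (_++ᴬ_ F xs ys)
  ArgIn-++ʳ []       a = a
  ArgIn-++ʳ (x ∷ xs) a = there (ArgIn-++ʳ xs a)

  emb-subst : ∀ {Ξ Ξ' a b} {s s' : Ne F Ξ a} {t : Ne F Ξ' b} (eq : s ≡ s') (d : Sub F s t) →
              emb F (subst (λ s → Sub F s t) eq d) ≗ᴿ emb F d
  emb-subst refl d x = refl

  record SubstitutedSub {Ξ Γ' Ξ' Θ c b} (e : Env Ξ Γ' Θ) (θ : Args F Γ' Θ)
                        {u : Ne F Ξ c} {t : Ne F Ξ' b} (d : Sub F u t) : Set where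
    field
      {ctx}    : Ctx
      env      : Env Ξ' ctx Θ
      args     : Args F ctx Θ
      sub      : Sub F (subNe F Θ e θ u) (subNe F Θ env args t)
      args≡    : args ≡ renArgs F (emb F sub) θ
      commutes : Commutes env (emb F d) (emb F sub) e

  subNe-Sub : ∀ {Ξ Γ' Ξ' Θ c b} (e : Env Ξ Γ' Θ) (θ : Args F Γ' Θ) → AllExpanded F θ →
              {u : Ne F Ξ c} {t : Ne F Ξ' b} (d : Sub F u t) → SubstitutedSub e θ d
  subNe-Sub e θ θ-exp ⊵-refl = record
    { env      = e
    ; args     = θ
    ; sub      = ⊵-refl
    ; args≡    = sym (renArgs-id (λ _ → refl) θ)
    ; commutes = Commutes-id e id (λ _ → refl)
    }
  subNe-Sub {Θ = Θ} e θ θ-exp {t = t} (⊵-arg {Δ = Δ} {h = h} {us = us} a d)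
    with subNe-Sub (liftEnvₙ Δ e) (renArgs F (wk Δ) θ) (AllExpanded-renArgs (wk Δ) θ θ-exp) d
       | subNe-head Θ e θ θ-exp h us
  ... | record { env = env ; args = args ; sub = sub ; args≡ = args≡ ; commutes = commutes }
      | p , h$us≡ = record
    { env      = env
    ; args     = args
    ; sub      = sub'
    ; args≡    = trans args≡ (renArgs-∘ emb-sub' θ)
    ; commutes = Commutes-wk Δ {e₁ = env} {ρ₀ = emb F d} commutes emb-sub'
    }
    where
    -- θ is expanded, so the substituted arguments of h stay the last arguments of the result.
    sub' : Sub F (subNe F Θ e θ (h $ us)) (subNe F Θ env args t)
    sub' = subst (λ s → Sub F s _) (sym h$us≡)
                 (⊵-arg (ArgIn-++ʳ (Partial.args p) (ArgIn-subArgs Θ e θ a)) sub)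
    emb-sub' : (λ x → emb F sub (wk Δ x)) ≗ᴿ emb F sub'
    emb-sub' x = sym (emb-subst (sym h$us≡) _ x)

lemma10 : ∀ {S : Set} (F : Ty S → Set) {Γ : Ctx {S}}
            (Y X : List (Ty S)) (σ τ : Ty S)
            (u : Tm F (Γ ⧺ Y) σ) (v : Tm F (Γ ⧺ Y) τ)
            (θ : Args F (Γ ⧺ X) Y)
          → Expanded F τ v
          → AllExpanded F θ
          → ⊵E F σ τ u v
          → ⊵E F σ τ (applyθ F Y X σ u θ) (applyθ F Y X τ v θ)
lemma10 F {Γ} Y X (Δ ⇒ c) (Z ⇒ a) u v θ _ θ-exp (_ , h , ts , v≡ , _ , t , d , rest , t≡) =
  _ , head p* , args p* , vθ≡ , _ , subNe F Y env θ' t , sub , subArgs F Y env θ' rest , tθ≡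
  where
  E : Env (Γ ⧺ Y) (Γ ⧺ X) Y
  E = θEnv F Y X
  open Partial
  open Σ (substPartial F E θ θ-exp (h · ts)) renaming (proj₁ to p*; proj₂ to h·ts↝p*)
  open SubstitutedSub (subNe-Sub F (liftEnvₙ Δ E) (renArgs F (wk Δ) θ)
                                   (AllExpanded-renArgs F (wk Δ) θ θ-exp) d)
    renaming (args to θ'; args≡ to θ'≡)
  vθ≡ : applyθ F Y X (Z ⇒ a) v θ ≡ expandedForm F p*
  vθ≡ = trans (cong (subNe F Y (liftEnvₙ Z E) (renArgs F (wk Z) θ)) v≡)
              (↝-expandedForm F E θ {p = h · ts} h·ts↝p*)
  tθ≡ : subNe F Y env θ' t
          ≡ _$⁺_ F (renP F (λ x → emb F sub (wk Δ x)) p*) (subArgs F Y env θ' rest)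
  tθ≡ = trans (cong (subNe F Y env θ') t≡)
              (h·ts↝p* (trans θ'≡ (renArgs-∘ F (λ _ → refl) θ))
                       (Commutes-wk Δ {e₁ = env} commutes (λ _ → refl)) rest)
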